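{- Let $k\ge1$, $\hat x\in X_\mathcal{A}^k$, and integers $0\le i\le j$. Then $$\sqrt{j+1}\;\theta_R^{\,i}\,\Xi^*_{j,0}(\hat x)=\sqrt{j-i+1}\;\Xi^*_{j-i,0}(\hat x),$$ and the same identity holds with $\theta_L$ in place of $\theta_R$.
   Context: $\mathcal{A}$ is a finite alphabet with $q$ letters, $V_\mathcal{A}=\mathbb{C}^q$ with standard basis $\{e_a\}$, $V_\mathcal{A}^m$ its $m$-fold tensor power. $f_0=q^{ -1/2}\sum_a e_a$. For $m\ge1$, $\theta_L,\theta_R:V_\mathcal{A}^m\to V_\mathcal{A}^{m-1}$ are linear with $\theta_L(v_1\otimes\cdots\otimes v_m)=\langle f_0,v_1\rangle v_2\otimes\cdots\otimes v_m$, $\theta_R(v_1\otimes\cdots\otimes v_m)=\langle f_0,v_m\rangle v_1\otimes\cdots\otimes v_{m-1}$; adjoints $\theta_L^*(u)=f_0\otimes u$, $\theta_R^*(u)=u\otimes f_0$. $X_\mathcal{A}^k=\ker\theta_L\cap\ker\theta_R\subseteq V_\mathcal{A}^k$. For $j\ge0$, $\Xi^*_{j,0}:V_\mathcal{A}^k\to V_\mathcal{A}^{k+j}$ is $\Xi^*_{j,0}(v)=\frac{1}{\sqrt{j+1}}\sum_{\ell=0}^{j}(\theta_L^*)^{j-\ell}(\theta_R^*)^{\ell}(v)$. -}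

module Defs where


open import Algebra.Bundles using (CommutativeRing)
open import Data.Nat using (ℕ; zero; suc; _∸_)
open import Data.Fin using (Fin; zero; suc)
open import Data.List using (List; []; _∷_; _++_; length)
open import Data.Product using (_×_)
open import Relation.Binary.PropositionalEquality using (_≢_)

-- Tensor powers V_A^m modelled over a commutative ring R of scalars
-- (the paper uses ℂ).  An element of the tensor algebra ⊕_m V_A^m is a
-- function on words over the alphabet Fin q (coefficient of
-- e_{a1} ⊗ ... ⊗ e_{am}); V_A^m = those supported on words of length m.
-- s plays the role of q^{-1/2}, the common coordinate of f_0.
module Tensor {c ℓ} (R : CommutativeRing c ℓ) (q : ℕ)
              (s : CommutativeRing.Carrier R) where
  open CommutativeRing R using (Carrier; _≈_; _+_; _*_; 0#; 1#)

  Word : Set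
  Word = List (Fin q)

  Tensor : Set c
  Tensor = Word → Carrier

  natR : ℕ → Carrier
  natR zero = 0#
  natR (suc n) = 1# + natR n

  sumFin : ∀ n → (Fin n → Carrier) → Carrier
  sumFin zero f = 0#
  sumFin (suc n) f = f zero + sumFin n (λ i → f (suc i))

  f0 : Fin q → Carrier
  f0 _ = s

  _≋_ : Tensor → Tensor → Set ℓ
  v ≋ u = ∀ w → v w ≈ u w

  zeroT : Tensor
  zeroT _ = 0#

  _·_ : Carrier → Tensor → Tensor
  (a · v) w = a * v w

  _⊕_ : Tensor → Tensor → Tensor
  (v ⊕ u) w = v w + u w

  Homogeneous : ℕ → Tensor → Set ℓ
  Homogeneous m v = ∀ w → length w ≢ m → v w ≈ 0#

  θL : Tensor → Tensor
  θL v w = sumFin q (λ a → f0 a * v (a ∷ w))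

  θR : Tensor → Tensor
  θR v w = sumFin q (λ a → f0 a * v (w ++ a ∷ []))

  -- adjoints: θ_L^* u = f_0 ⊗ u,  θ_R^* u = u ⊗ f_0
  θL* : Tensor → Tensor
  θL* u [] = 0#
  θL* u (a ∷ w) = f0 a * u w

  -- (θR* u) (w ++ [a]) = f0 a * u w
  θR* : Tensor → Tensor
  θR* u [] = 0#
  θR* u (a ∷ []) = f0 a * u []
  θR* u (a ∷ b ∷ w) = θR* (λ x → u (a ∷ x)) (b ∷ w)

  iter : ℕ → (Tensor → Tensor) → Tensor → Tensor
  iter zero f v = v
  iter (suc n) f v = f (iter n f v)

  InX : ℕ → Tensor → Set ℓ
  InX k v = Homogeneous k v × (θL v ≋ zeroT) × (θR v ≋ zeroT)

  sumTo : ℕ → (ℕ → Tensor) → Tensor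
  sumTo zero F = F zero
  sumTo (suc j) F = sumTo j F ⊕ F (suc j)

  -- Ξ*_{j,0} v = (1/√(j+1)) Σ_{l=0}^{j} (θ_L^*)^{j-l} (θ_R^*)^l v,
  -- where rtInv j stands for 1/√(j+1)
  Ξ* : (rtInv : ℕ → Carrier) → ℕ → Tensor → Tensor
  Ξ* rtInv j v = rtInv j · sumTo j (λ l → iter (j ∸ l) θL* (iter l θR* v))

-- Since ⟨f₀, f₀⟩ = 1, contracting a factor f₀ back off undoes θ_L^* resp. θ_R^*, and a
-- contraction at one end commutes with tensoring f₀ onto the other end.  Writing
-- Ξ*_{j,0} x̂ = (j+1)^{-1/2} S_j, θ_R therefore sends the term (θ_L^*)^{j+1} x̂ of S_{j+1}
-- to (θ_L^*)^{j+1} (θ_R x̂) = 0 and strips one θ_R^* from every other term, so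
-- θ_R S_{j+1} = S_j; symmetrically θ_L S_{j+1} = S_j.  Iterating gives θ^i S_j = S_{j-i},
-- and the normalising factors cancel against √(j+1) and √(j-i+1).
module Submission where

open import Defs
open import Algebra.Bundles using (CommutativeRing)
open import Data.Nat using (ℕ; zero; suc; _∸_; _≤_; z≤n; s≤s)
open import Data.Nat.Properties using (+-∸-assoc; n∸n≡0; ≤-refl; m≤n⇒m≤1+n)
open import Data.Fin using (Fin) renaming (zero to fzero; suc to fsuc)
open import Data.List.Base using ([]; _∷_; _∷ʳ_; _∷ʳ′_; initLast)
open import Data.Product using (_×_; _,_)
open import Level using (_⊔_)
open import Relation.Binary.PropositionalEquality as ≡ using (_≡_)
import Relation.Binary.Reasoning.Setoid as SetoidReasoning
import Algebra.Properties.CommutativeSemigroup as CommutativeSemigroupProperties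

module TensorProperties {c ℓ} (R : CommutativeRing c ℓ) (q : ℕ)
                        (s : CommutativeRing.Carrier R) where
  open CommutativeRing R
  open Tensor R q s
  open SetoidReasoning setoid
  open CommutativeSemigroupProperties +-commutativeSemigroup using (interchange)
  open CommutativeSemigroupProperties *-commutativeSemigroup using (x∙yz≈y∙xz; xy∙z≈xz∙y)

  sumFin-cong : ∀ n {f g : Fin n → Carrier} → (∀ a → f a ≈ g a) → sumFin n f ≈ sumFin n g
  sumFin-cong zero    f≈g = refl
  sumFin-cong (suc n) f≈g = +-cong (f≈g fzero) (sumFin-cong n (λ a → f≈g (fsuc a)))

  sumFin-distribˡ : ∀ n d (f : Fin n → Carrier) → sumFin n (λ a → d * f a) ≈ d * sumFin n f
  sumFin-distribˡ zero    d f = sym (zeroʳ d)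
  sumFin-distribˡ (suc n) d f =
    trans (+-cong refl (sumFin-distribˡ n d (λ a → f (fsuc a)))) (sym (distribˡ d _ _))

  sumFin-+ : ∀ n (f g : Fin n → Carrier) → sumFin n (λ a → f a + g a) ≈ sumFin n f + sumFin n g
  sumFin-+ zero    f g = sym (+-identityʳ 0#)
  sumFin-+ (suc n) f g =
    trans (+-cong refl (sumFin-+ n (λ a → f (fsuc a)) (λ a → g (fsuc a)))) (interchange _ _ _ _)

  sumFin-const : ∀ n d → sumFin n (λ _ → d) ≈ d * natR n
  sumFin-const zero    d = sym (zeroʳ d)
  sumFin-const (suc n) d = begin
    d + sumFin n (λ _ → d)  ≈⟨ +-cong (sym (*-identityʳ d)) (sumFin-const n d) ⟩
    d * 1# + d * natR n     ≈⟨ sym (distribˡ d 1# (natR n)) ⟩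
    d * (1# + natR n)       ∎

  record IsLinear (op : Tensor → Tensor) : Set (c ⊔ ℓ) where
    field
      cong  : ∀ {u v} → u ≋ v → op u ≋ op v
      ⊕-hom : ∀ u v → op (u ⊕ v) ≋ (op u ⊕ op v)
      ·-hom : ∀ d u → op (d · u) ≋ (d · op u)

    zero-hom : ∀ {u} → u ≋ zeroT → op u ≋ zeroT
    zero-hom {u} u≋0 w = begin
      op u w           ≈⟨ cong (λ w′ → trans (u≋0 w′) (sym (zeroˡ (u w′)))) w ⟩
      op (0# · u) w    ≈⟨ ·-hom 0# u w ⟩
      0# * op u w      ≈⟨ zeroˡ _ ⟩
      0#               ∎

    sumTo-hom : ∀ j F → op (sumTo j F) ≋ sumTo j (λ l → op (F l))
    sumTo-hom zero    F w = refl
    sumTo-hom (suc j) F w = trans (⊕-hom _ _ w) (+-cong (sumTo-hom j F w) refl)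

  iter-isLinear : ∀ {op} → IsLinear op → ∀ m → IsLinear (iter m op)
  iter-isLinear op-lin zero = record
    { cong = λ u≋v → u≋v ; ⊕-hom = λ _ _ _ → refl ; ·-hom = λ _ _ _ → refl }
  iter-isLinear {op} op-lin (suc m) = record
    { cong  = λ u≋v → cong (IsLinear.cong opᵐ-lin u≋v)
    ; ⊕-hom = λ u v w → trans (cong (IsLinear.⊕-hom opᵐ-lin u v) w) (⊕-hom _ _ w)
    ; ·-hom = λ d u w → trans (cong (IsLinear.·-hom opᵐ-lin d u) w) (·-hom _ _ w)
    }
    where
      open IsLinear op-lin
      opᵐ-lin : IsLinear (iter m op)
      opᵐ-lin = iter-isLinear op-lin m

  iter-suc : ∀ m (op : Tensor → Tensor) u → iter (suc m) op u ≡ iter m op (op u)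
  iter-suc zero    op u = ≡.refl
  iter-suc (suc m) op u = ≡.cong op (iter-suc m op u)

  contraction : (Word → Fin q → Word) → Tensor → Tensor
  contraction place v w = sumFin q (λ a → f0 a * v (place w a))

  contraction-isLinear : ∀ place → IsLinear (contraction place)
  contraction-isLinear place = record
    { cong  = λ u≋v w → sumFin-cong q (λ a → *-cong refl (u≋v _))
    ; ⊕-hom = λ u v w → trans (sumFin-cong q (λ a → distribˡ _ _ _)) (sumFin-+ q _ _)
    ; ·-hom = λ d u w → trans (sumFin-cong q (λ a → x∙yz≈y∙xz _ d _)) (sumFin-distribˡ q d _)
    }

  θL-isLinear : IsLinear θL
  θL-isLinear = contraction-isLinear (λ w a → a ∷ w)

  θR-isLinear : IsLinear θR
  θR-isLinear = contraction-isLinear (λ w a → w ∷ʳ a)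

  θL*-isLinear : IsLinear θL*
  θL*-isLinear = record { cong = cong ; ⊕-hom = ⊕-hom ; ·-hom = ·-hom }
    where
      cong : ∀ {u v} → u ≋ v → θL* u ≋ θL* v
      cong u≋v []      = refl
      cong u≋v (a ∷ w) = *-cong refl (u≋v w)
      ⊕-hom : ∀ u v → θL* (u ⊕ v) ≋ (θL* u ⊕ θL* v)
      ⊕-hom u v []      = sym (+-identityʳ 0#)
      ⊕-hom u v (a ∷ w) = distribˡ _ _ _
      ·-hom : ∀ d u → θL* (d · u) ≋ (d · θL* u)
      ·-hom d u []      = sym (zeroʳ d)
      ·-hom d u (a ∷ w) = x∙yz≈y∙xz _ d _

  θR*-isLinear : IsLinear θR*
  θR*-isLinear = record { cong = cong ; ⊕-hom = ⊕-hom ; ·-hom = ·-hom }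
    where
      cong : ∀ {u v} → u ≋ v → θR* u ≋ θR* v
      cong u≋v []          = refl
      cong u≋v (a ∷ [])    = *-cong refl (u≋v [])
      cong u≋v (a ∷ b ∷ w) = cong (λ w′ → u≋v (a ∷ w′)) (b ∷ w)
      ⊕-hom : ∀ u v → θR* (u ⊕ v) ≋ (θR* u ⊕ θR* v)
      ⊕-hom u v []          = sym (+-identityʳ 0#)
      ⊕-hom u v (a ∷ [])    = distribˡ _ _ _
      ⊕-hom u v (a ∷ b ∷ w) = ⊕-hom (λ w′ → u (a ∷ w′)) (λ w′ → v (a ∷ w′)) (b ∷ w)
      ·-hom : ∀ d u → θR* (d · u) ≋ (d · θR* u)
      ·-hom d u []          = sym (zeroʳ d)
      ·-hom d u (a ∷ [])    = x∙yz≈y∙xz _ d _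
      ·-hom d u (a ∷ b ∷ w) = ·-hom d (λ w′ → u (a ∷ w′)) (b ∷ w)

  θR*-∷ʳ : ∀ u w a → θR* u (w ∷ʳ a) ≡ s * u w
  θR*-∷ʳ u []          a = ≡.refl
  θR*-∷ʳ u (b ∷ [])    a = ≡.refl
  θR*-∷ʳ u (b ∷ c ∷ w) a = θR*-∷ʳ (λ w′ → u (b ∷ w′)) (c ∷ w) a

  sumTo-cong : ∀ j {F G} → (∀ l → l ≤ j → F l ≋ G l) → sumTo j F ≋ sumTo j G
  sumTo-cong zero    F≋G w = F≋G 0 z≤n w
  sumTo-cong (suc j) F≋G w =
    +-cong (sumTo-cong j (λ l l≤j → F≋G l (m≤n⇒m≤1+n l≤j)) w) (F≋G (suc j) ≤-refl w)

  sumTo-unsnoc : ∀ j F → sumTo (suc j) F ≋ (F 0 ⊕ sumTo j (λ l → F (suc l)))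
  sumTo-unsnoc zero    F w = refl
  sumTo-unsnoc (suc j) F w = trans (+-cong (sumTo-unsnoc j F w) refl) (+-assoc _ _ _)

  iter-descent : ∀ {op} → IsLinear op → (S : ℕ → Tensor) → (∀ j → op (S (suc j)) ≋ S j) →
                 ∀ {i j} → i ≤ j → iter i op (S j) ≋ S (j ∸ i)
  iter-descent op-lin S step {zero}  {j}     _         w = refl
  iter-descent {op} op-lin S step {suc i} {suc j} (s≤s i≤j) w = begin
    iter (suc i) op (S (suc j)) w  ≡⟨ ≡.cong (λ v → v w) (iter-suc i _ (S (suc j))) ⟩
    iter i op (op (S (suc j))) w   ≈⟨ IsLinear.cong (iter-isLinear op-lin i) (step j) w ⟩
    iter i op (S j) w              ≈⟨ iter-descent op-lin S step i≤j w ⟩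
    S (j ∸ i) w                    ∎

  iter-commute : ∀ {A} → IsLinear A → (∀ u → A u [] ≈ 0#) → (B : Tensor → Tensor) →
                 (∀ u → u [] ≈ 0# → B (A u) ≋ A (B u)) →
                 ∀ m u → u [] ≈ 0# → B (iter m A u) ≋ iter m A (B u)
  iter-commute A-lin A-ε B B∘A zero    u u-ε w = refl
  iter-commute {A} A-lin A-ε B B∘A (suc m) u u-ε w =
    trans (B∘A _ (iterᵐ-ε m) w) (IsLinear.cong A-lin (iter-commute A-lin A-ε B B∘A m u u-ε) w)
    where
      iterᵐ-ε : ∀ m → iter m A u [] ≈ 0#
      iterᵐ-ε zero    = u-ε
      iterᵐ-ε (suc m) = A-ε _

  module UnitVector (f0-unit : s * s * natR q ≈ 1#) where

    sumFin-s*s* : ∀ y → sumFin q (λ _ → s * (s * y)) ≈ y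
    sumFin-s*s* y = begin
      sumFin q (λ _ → s * (s * y))  ≈⟨ sumFin-const q _ ⟩
      s * (s * y) * natR q          ≈⟨ *-cong (sym (*-assoc s s y)) refl ⟩
      s * s * y * natR q            ≈⟨ xy∙z≈xz∙y (s * s) y (natR q) ⟩
      s * s * natR q * y            ≈⟨ *-cong f0-unit refl ⟩
      1# * y                        ≈⟨ *-identityˡ y ⟩
      y                             ∎

    θL∘θL* : ∀ u → θL (θL* u) ≋ u
    θL∘θL* u w = sumFin-s*s* (u w)

    θR∘θR* : ∀ u → θR (θR* u) ≋ u
    θR∘θR* u w = trans (sumFin-cong q (λ a → *-cong refl (reflexive (θR*-∷ʳ u w a))))
                       (sumFin-s*s* (u w))

    -- On the empty word the left side is ⟨f₀, f₀⟩ u [] but the right side is 0#.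
    θR∘θL* : ∀ u → u [] ≈ 0# → θR (θL* u) ≋ θL* (θR u)
    θR∘θL* u u-ε []      = trans (sumFin-s*s* (u [])) u-ε
    θR∘θL* u u-ε (b ∷ w) = sumFin-distribˡ q s _

    θL∘θR* : ∀ u → u [] ≈ 0# → θL (θR* u) ≋ θR* (θL u)
    θL∘θR* u u-ε w with initLast w
    ... | []       = trans (sumFin-s*s* (u [])) u-ε
    ... | w′ ∷ʳ′ b = begin
      sumFin q (λ a → s * θR* u ((a ∷ w′) ∷ʳ b))
        ≈⟨ sumFin-cong q (λ a → *-cong refl (reflexive (θR*-∷ʳ u (a ∷ w′) b))) ⟩
      sumFin q (λ a → s * (s * u (a ∷ w′)))  ≈⟨ sumFin-distribˡ q s _ ⟩
      s * θL u w′                             ≡⟨ ≡.sym (θR*-∷ʳ (θL u) w′ b) ⟩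
      θR* (θL u) (w′ ∷ʳ b)                    ∎

    θR∘iterθL* : ∀ m u → u [] ≈ 0# → θR (iter m θL* u) ≋ iter m θL* (θR u)
    θR∘iterθL* = iter-commute θL*-isLinear (λ _ → refl) θR θR∘θL*

    θL∘iterθR* : ∀ m u → u [] ≈ 0# → θL (iter m θR* u) ≋ iter m θR* (θL u)
    θL∘iterθR* = iter-commute θR*-isLinear (λ _ → refl) θL θL∘θR*

    module Ξ*Sum (x : Tensor) (x-ε : x [] ≈ 0#) (θL-x : θL x ≋ zeroT) (θR-x : θR x ≋ zeroT) where

      -- Ξ* rtInv j x = rtInv j · Ξ*-sum j, definitionally
      Ξ*-term : ℕ → ℕ → Tensor
      Ξ*-term j l = iter (j ∸ l) θL* (iter l θR* x)

      Ξ*-sum : ℕ → Tensor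
      Ξ*-sum j = sumTo j (Ξ*-term j)

      θR-Ξ*-term-zero : ∀ j → θR (Ξ*-term j 0) ≋ zeroT
      θR-Ξ*-term-zero j w =
        trans (θR∘iterθL* j x x-ε w) (IsLinear.zero-hom (iter-isLinear θL*-isLinear j) θR-x w)

      θR-Ξ*-term-suc : ∀ j l → θR (Ξ*-term (suc j) (suc l)) ≋ Ξ*-term j l
      θR-Ξ*-term-suc j l w =
        trans (θR∘iterθL* (j ∸ l) _ refl w)
              (IsLinear.cong (iter-isLinear θL*-isLinear (j ∸ l)) (θR∘θR* (iter l θR* x)) w)

      θL-Ξ*-term-last : ∀ j → θL (Ξ*-term j j) ≋ zeroT
      θL-Ξ*-term-last j w = begin
        θL (iter (j ∸ j) θL* (iter j θR* x)) w
          ≡⟨ ≡.cong (λ m → θL (iter m θL* (iter j θR* x)) w) (n∸n≡0 j) ⟩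
        θL (iter j θR* x) w    ≈⟨ θL∘iterθR* j x x-ε w ⟩
        iter j θR* (θL x) w    ≈⟨ IsLinear.zero-hom (iter-isLinear θR*-isLinear j) θL-x w ⟩
        0#                     ∎

      θL-Ξ*-term : ∀ {j l} → l ≤ j → θL (Ξ*-term (suc j) l) ≋ Ξ*-term j l
      θL-Ξ*-term {j} {l} l≤j w = begin
        θL (iter (suc j ∸ l) θL* (iter l θR* x)) w
          ≡⟨ ≡.cong (λ m → θL (iter m θL* (iter l θR* x)) w) (+-∸-assoc 1 l≤j) ⟩
        θL (θL* (Ξ*-term j l)) w  ≈⟨ θL∘θL* (Ξ*-term j l) w ⟩
        Ξ*-term j l w             ∎

      θR-Ξ*-sum : ∀ j → θR (Ξ*-sum (suc j)) ≋ Ξ*-sum j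
      θR-Ξ*-sum j w = begin
        θR (Ξ*-sum (suc j)) w
          ≈⟨ θR.cong (sumTo-unsnoc j (Ξ*-term (suc j))) w ⟩
        θR (Ξ*-term (suc j) 0 ⊕ sumTo j (λ l → Ξ*-term (suc j) (suc l))) w
          ≈⟨ θR.⊕-hom (Ξ*-term (suc j) 0) (sumTo j (λ l → Ξ*-term (suc j) (suc l))) w ⟩
        θR (Ξ*-term (suc j) 0) w + θR (sumTo j (λ l → Ξ*-term (suc j) (suc l))) w
          ≈⟨ +-cong (θR-Ξ*-term-zero (suc j) w) (θR.sumTo-hom j _ w) ⟩
        0# + sumTo j (λ l → θR (Ξ*-term (suc j) (suc l))) w
          ≈⟨ +-identityˡ _ ⟩
        sumTo j (λ l → θR (Ξ*-term (suc j) (suc l))) w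
          ≈⟨ sumTo-cong j (λ l _ → θR-Ξ*-term-suc j l) w ⟩
        Ξ*-sum j w ∎
        where module θR = IsLinear θR-isLinear

      θL-Ξ*-sum : ∀ j → θL (Ξ*-sum (suc j)) ≋ Ξ*-sum j
      θL-Ξ*-sum j w = begin
        θL (sumTo j (Ξ*-term (suc j)) ⊕ Ξ*-term (suc j) (suc j)) w
          ≈⟨ θL.⊕-hom (sumTo j (Ξ*-term (suc j))) (Ξ*-term (suc j) (suc j)) w ⟩
        θL (sumTo j (Ξ*-term (suc j))) w + θL (Ξ*-term (suc j) (suc j)) w
          ≈⟨ +-cong (θL.sumTo-hom j _ w) (θL-Ξ*-term-last (suc j) w) ⟩
        sumTo j (λ l → θL (Ξ*-term (suc j) l)) w + 0#
          ≈⟨ +-identityʳ _ ⟩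
        sumTo j (λ l → θL (Ξ*-term (suc j) l)) w
          ≈⟨ sumTo-cong j (λ l l≤j → θL-Ξ*-term l≤j) w ⟩
        Ξ*-sum j w ∎
        where module θL = IsLinear θL-isLinear

mainTheorem10 : ∀ {c ℓ} (R : CommutativeRing c ℓ) (q : ℕ)
    (s : CommutativeRing.Carrier R) (rt rtInv : ℕ → CommutativeRing.Carrier R) →
    let open CommutativeRing R
        open Tensor R q s
    in s * s * natR q ≈ 1# →
       (∀ n → rt n * rt n ≈ natR (suc n)) →
       (∀ n → rt n * rtInv n ≈ 1#) →
       (k : ℕ) → 1 ≤ k → (x : Tensor) → InX k x →
       (i j : ℕ) → i ≤ j →
       ((rt j · iter i θR (Ξ* rtInv j x)) ≋ (rt (j ∸ i) · Ξ* rtInv (j ∸ i) x))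
       × ((rt j · iter i θL (Ξ* rtInv j x)) ≋ (rt (j ∸ i) · Ξ* rtInv (j ∸ i) x))
mainTheorem10 R q s rt rtInv f0-unit _ rt-rtInv (suc k) (s≤s _) x (x-hom , θL-x , θR-x) i j i≤j =
  rescale θR-isLinear (iter-descent θR-isLinear Ξ*-sum θR-Ξ*-sum i≤j) ,
  rescale θL-isLinear (iter-descent θL-isLinear Ξ*-sum θL-Ξ*-sum i≤j)
  where
    open CommutativeRing R
    open Tensor R q s
    open TensorProperties R q s
    open UnitVector f0-unit
    open Ξ*Sum x (x-hom [] (λ ())) θL-x θR-x
    open SetoidReasoning setoid

    rt-rtInv-cancel : ∀ n y → rt n * (rtInv n * y) ≈ y
    rt-rtInv-cancel n y =
      trans (sym (*-assoc _ _ y)) (trans (*-cong (rt-rtInv n) refl) (*-identityˡ y))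

    rescale : ∀ {op} → IsLinear op → iter i op (Ξ*-sum j) ≋ Ξ*-sum (j ∸ i) →
              (rt j · iter i op (Ξ* rtInv j x)) ≋ (rt (j ∸ i) · Ξ* rtInv (j ∸ i) x)
    rescale {op} op-lin descent w = begin
      rt j * iter i op (rtInv j · Ξ*-sum j) w
        ≈⟨ *-cong refl (IsLinear.·-hom (iter-isLinear op-lin i) (rtInv j) (Ξ*-sum j) w) ⟩
      rt j * (rtInv j * iter i op (Ξ*-sum j) w)  ≈⟨ rt-rtInv-cancel j _ ⟩
      iter i op (Ξ*-sum j) w                      ≈⟨ descent w ⟩
      Ξ*-sum (j ∸ i) w                            ≈⟨ sym (rt-rtInv-cancel (j ∸ i) _) ⟩
      rt (j ∸ i) * (rtInv (j ∸ i) * Ξ*-sum (j ∸ i) w) ∎
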